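{- Let $\Gamma\vdash T$ be a discrete type in the presheaf CwF over $\mathrm{BPCube}$. Then the type $\P\Gamma\vdash\P T$ is also discrete.
   Context: Fix an infinite set of names. $\mathrm{BPCube}$ has as objects pairs $W=(W_{\mathbb B},W_{\mathbb P})$ of disjoint finite sets of names; $(W,i:\mathbb P)$ denotes $(W_{\mathbb B},W_{\mathbb P}\uplus\{i\})$ for a fresh name $i$. A morphism $\varphi:V\to W$ assigns to each $i\in W_{\mathbb B}$ an element of $\{0,1\}\cup V_{\mathbb B}$ and to each $i\in W_{\mathbb P}$ an element of $\{0,1\}\cup V_{\mathbb B}\cup V_{\mathbb P}$; composition is substitution. $\mathrm{wk}_i:(W,i:\mathbb P)\to W$ sends every name of $W$ to itself. The functor $\sharp:\mathrm{BPCube}\to\mathrm{BPCube}$ sends $(W_{\mathbb B},W_{\mathbb P})$ to $(\emptyset,W_{\mathbb B}\cup W_{\mathbb P})$ (all dimensions become path dimensions) and a face map to the face map with the same assignment of names. $\P$ is precomposition with $\sharp$: $(\P\Gamma)(W)=\Gamma(\sharp W)$, and for a type $\Gamma\vdash T$, the type $\P\Gamma\vdash\P T$ has $(\P T)[\gamma]=T[\gamma]$ for $\gamma\in\Gamma(\sharp W)$, with restriction along $\varphi$ given by restriction in $T$ along $\sharp\varphi$. A type $\Gamma\vdash T$ gives sets $T[\gamma]$ with functorial restrictions $t\langle\varphi\rangle\in T[\gamma\cdot\varphi]$. $\gamma\in\Gamma(W,i:\mathbb P)$ is degenerate in $i$ if $\gamma=\gamma'\cdot\mathrm{wk}_i$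 for some $\gamma'$; $t\in T[\gamma]$ is degenerate in $i$ if moreover $t=t'\langle\mathrm{wk}_i\rangle$ for some $t'\in T[\gamma']$. $T$ is discrete if whenever $\gamma$ is degenerate in a path dimension $i$, every $t\in T[\gamma]$ is degenerate in $i$. -}

module Defs where

open import Data.Nat using (ℕ; _<_; _+_; suc; _≡ᵇ_)
open import Data.Nat.Properties using (≡ᵇ⇒≡; m≤m+n; m≤n+m; <-≤-trans)
open import Data.Bool using (Bool; true; false; T; _∨_)
open import Data.Bool.Properties using (T-∨)
open import Data.Unit using (⊤; tt)
open import Data.Empty using (⊥; ⊥-elim)
open import Data.Sum using (_⊎_; inj₁; inj₂)
open import Data.Product using (Σ; Σ-syntax; _,_; proj₁; proj₂)
open import Function.Bundles using (Equivalence)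
open import Relation.Binary.PropositionalEquality
  using (_≡_; refl; sym; trans; cong; subst; subst-subst)

Name : Set
Name = ℕ

-- An object W = (W_B , W_P): two disjoint finite sets of names, given by
-- their (decidable) characteristic functions.
record Obj : Set where
  constructor obj
  field
    B    : Name → Bool     -- W_B : bridge dimensions
    P    : Name → Bool     -- W_P : path dimensions
    disj : ∀ i → T (B i) → T (P i) → ⊥
    fin  : Σ[ n ∈ ℕ ] (∀ i → T (B i ∨ P i) → i < n)
open Obj public

-- Possible values of a dimension under a face map: 0, 1 or a name.
data Code : Set where
  c0 c1 : Code
  nm    : Name → Code

okB : Obj → Code → Set
okB V c0     = ⊤
okB V c1     = ⊤
okB V (nm j) = T (B V j)

okP : Obj → Code → Set
okP V c0     = ⊤
okP V c1     = ⊤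
okP V (nm j) = T (B V j ∨ P V j)

-- A morphism φ : V → W assigns to each i ∈ W_B an element of {0,1} ∪ V_B
-- and to each i ∈ W_P an element of {0,1} ∪ V_B ∪ V_P.
-- (Values of f outside W_B ∪ W_P are irrelevant; see _≈_.)
record Hom (V W : Obj) : Set where
  constructor hom
  field
    f   : Name → Code
    wfB : ∀ i → T (B W i) → okB V (f i)
    wfP : ∀ i → T (P W i) → okP V (f i)
open Hom public

_≈_ : ∀ {V W} → Hom V W → Hom V W → Set
_≈_ {V} {W} φ ψ = ∀ i → T (B W i ∨ P W i) → f φ i ≡ f ψ i

T-∨ˡ : ∀ {x y} → T x → T (x ∨ y)
T-∨ˡ p = Equivalence.from T-∨ (inj₁ p)

T-∨ʳ : ∀ {x y} → T y → T (x ∨ y)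
T-∨ʳ p = Equivalence.from T-∨ (inj₂ p)

okB⇒okP : ∀ V c → okB V c → okP V c
okB⇒okP V c0     p = tt
okB⇒okP V c1     p = tt
okB⇒okP V (nm j) p = T-∨ˡ p

wfBP : ∀ {V W} (φ : Hom V W) i → T (B W i ∨ P W i) → okP V (f φ i)
wfBP {V} {W} φ i p with Equivalence.to T-∨ p
... | inj₁ q = okB⇒okP V (f φ i) (wfB φ i q)
... | inj₂ q = wfP φ i q

idH : ∀ {W} → Hom W W
idH = hom nm (λ i p → p) (λ i p → T-∨ʳ p)

sub : (Name → Code) → Code → Code
sub g c0     = c0
sub g c1     = c1
sub g (nm j) = g j

subB : ∀ {U V} (ψ : Hom U V) c → okB V c → okB U (sub (f ψ) c)
subB ψ c0     p = tt
subB ψ c1     p = tt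
subB ψ (nm j) p = wfB ψ j p

subP : ∀ {U V} (ψ : Hom U V) c → okP V c → okP U (sub (f ψ) c)
subP ψ c0     p = tt
subP ψ c1     p = tt
subP ψ (nm j) p = wfBP ψ j p

_∘H_ : ∀ {U V W} → Hom V W → Hom U V → Hom U W
φ ∘H ψ = hom (λ i → sub (f ψ) (f φ i))
             (λ i p → subB ψ (f φ i) (wfB φ i p))
             (λ i p → subP ψ (f φ i) (wfP φ i p))

Fresh : Obj → Name → Set
Fresh W i = T (B W i ∨ P W i) → ⊥

ext : (W : Obj) (i : Name) → Fresh W i → Obj
ext W i fr = obj (B W) (λ j → P W j ∨ (j ≡ᵇ i)) dj fn
  where
  dj : ∀ j → T (B W j) → T (P W j ∨ (j ≡ᵇ i)) → ⊥
  dj j b q with Equivalence.to T-∨ q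
  ... | inj₁ p = disj W j b p
  ... | inj₂ e = fr (subst (λ k → T (B W k ∨ P W k)) (≡ᵇ⇒≡ j i e) (T-∨ˡ {B W j} {P W j} b))
  n = proj₁ (fin W)
  fn : Σ[ m ∈ ℕ ] (∀ j → T (B W j ∨ (P W j ∨ (j ≡ᵇ i))) → j < m)
  fn = n + suc i , g
    where
    g : ∀ j → T (B W j ∨ (P W j ∨ (j ≡ᵇ i))) → j < n + suc i
    g j q with Equivalence.to T-∨ q
    ... | inj₁ b = <-≤-trans (proj₂ (fin W) j (T-∨ˡ {B W j} {P W j} b)) (m≤m+n n (suc i))
    ... | inj₂ q' with Equivalence.to T-∨ q'
    ...   | inj₁ p = <-≤-trans (proj₂ (fin W) j (T-∨ʳ {B W j} {P W j} p)) (m≤m+n n (suc i))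
    ...   | inj₂ e = subst (λ k → k < n + suc i) (sym (≡ᵇ⇒≡ j i e)) (m≤n+m (suc i) n)

wk : (W : Obj) (i : Name) (fr : Fresh W i) → Hom (ext W i fr) W
wk W i fr = hom nm (λ j p → p) (λ j p → T-∨ʳ {B W j} (T-∨ˡ {P W j} {j ≡ᵇ i} p))

♯ : Obj → Obj
♯ W = obj (λ _ → false) (λ i → B W i ∨ P W i) (λ i ()) (fin W)

okP♯ : ∀ V c → okP V c → okP (♯ V) c
okP♯ V c0     p = p
okP♯ V c1     p = p
okP♯ V (nm j) p = p

♯H : ∀ {V W} → Hom V W → Hom (♯ V) (♯ W)
♯H {V} φ = hom (f φ) (λ i ()) (λ i p → okP♯ V (f φ i) (wfBP φ i p))

♯-resp : ∀ {V W} {φ ψ : Hom V W} → _≈_ {V} {W} φ ψ → _≈_ {♯ V} {♯ W} (♯H φ) (♯H ψ)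
♯-resp e = e

record Psh : Set₁ where
  field
    Ob   : Obj → Set
    _·_  : ∀ {V W} → Ob W → Hom V W → Ob V
    resp : ∀ {V W} (γ : Ob W) {φ ψ : Hom V W} → φ ≈ ψ → γ · φ ≡ γ · ψ
    ·-id : ∀ {W} (γ : Ob W) → γ · idH ≡ γ
    ·-∘  : ∀ {U V W} (γ : Ob W) (φ : Hom V W) (ψ : Hom U V) →
           (γ · φ) · ψ ≡ γ · (φ ∘H ψ)
open Psh public

record Ty (Γ : Psh) : Set₁ where
  field
    El   : ∀ {W} → Ob Γ W → Set
    _⟨_⟩ : ∀ {V W} {γ : Ob Γ W} → El γ → (φ : Hom V W) → El (_·_ Γ γ φ)
    resp : ∀ {V W} {γ : Ob Γ W} (t : El γ) {φ ψ : Hom V W} (e : φ ≈ ψ) →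
           subst El (Psh.resp Γ γ e) (t ⟨ φ ⟩) ≡ t ⟨ ψ ⟩
    ⟨id⟩ : ∀ {W} {γ : Ob Γ W} (t : El γ) → subst El (·-id Γ γ) (t ⟨ idH ⟩) ≡ t
    ⟨∘⟩  : ∀ {U V W} {γ : Ob Γ W} (t : El γ) (φ : Hom V W) (ψ : Hom U V) →
           subst El (·-∘ Γ γ φ ψ) ((t ⟨ φ ⟩) ⟨ ψ ⟩) ≡ t ⟨ φ ∘H ψ ⟩
open Ty public

module _ {Γ : Psh} (A : Ty Γ) where
  private
    _·Γ_ : ∀ {V W} → Ob Γ W → Hom V W → Ob Γ V
    _·Γ_ = _·_ Γ
    _⟨_⟩A : ∀ {V W} {γ : Ob Γ W} → El A γ → (φ : Hom V W) → El A (γ ·Γ φ)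
    _⟨_⟩A = _⟨_⟩ A

  DegCtx : (W : Obj) (i : Name) (fr : Fresh W i) → Ob Γ (ext W i fr) → Set
  DegCtx W i fr γ = Σ[ γ' ∈ Ob Γ W ] (γ' ·Γ wk W i fr ≡ γ)

  DegTy : (W : Obj) (i : Name) (fr : Fresh W i) (γ : Ob Γ (ext W i fr)) →
          El A γ → Set
  DegTy W i fr γ t =
    Σ[ γ' ∈ Ob Γ W ] Σ[ e ∈ γ' ·Γ wk W i fr ≡ γ ]
      Σ[ t' ∈ El A γ' ] (subst (El A) e (t' ⟨ wk W i fr ⟩A) ≡ t)

  Discrete : Set
  Discrete = ∀ (W : Obj) (i : Name) (fr : Fresh W i) (γ : Ob Γ (ext W i fr)) →
             DegCtx W i fr γ → (t : El A γ) → DegTy W i fr γ t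

♯-id : ∀ {W} → _≈_ {♯ W} {♯ W} (♯H (idH {W})) (idH {♯ W})
♯-id i p = refl

♯-∘ : ∀ {U V W} (φ : Hom V W) (ψ : Hom U V) → _≈_ {♯ U} {♯ W} (♯H φ ∘H ♯H ψ) (♯H (φ ∘H ψ))
♯-∘ φ ψ i p = refl

module 𝐏Def (Γ : Psh) where
  Ob' : Obj → Set
  Ob' W = Ob Γ (♯ W)

  act : ∀ {V W} → Ob' W → Hom V W → Ob' V
  act {V} {W} γ φ = _·_ Γ {♯ V} {♯ W} γ (♯H φ)

  resp' : ∀ {V W} (γ : Ob' W) {φ ψ : Hom V W} → φ ≈ ψ → act {V} {W} γ φ ≡ act {V} {W} γ ψ
  resp' {V} {W} γ {φ} {ψ} e = Psh.resp Γ {♯ V} {♯ W} γ {♯H φ} {♯H ψ} (♯-resp {V} {W} {φ} {ψ} e)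

  id' : ∀ {W} (γ : Ob' W) → act {W} {W} γ idH ≡ γ
  id' {W} γ = trans (Psh.resp Γ {♯ W} {♯ W} γ {♯H {W} {W} idH} {idH} (♯-id {W})) (·-id Γ {♯ W} γ)

  comp' : ∀ {U V W} (γ : Ob' W) (φ : Hom V W) (ψ : Hom U V) →
          act {U} {V} (act {V} {W} γ φ) ψ ≡ act {U} {W} γ (φ ∘H ψ)
  comp' {U} {V} {W} γ φ ψ =
    trans (·-∘ Γ {♯ U} {♯ V} {♯ W} γ (♯H φ) (♯H ψ))
          (Psh.resp Γ {♯ U} {♯ W} γ {♯H φ ∘H ♯H ψ} {♯H (φ ∘H ψ)} (♯-∘ φ ψ))

𝐏 : Psh → Psh
𝐏 Γ = record
  { Ob   = Ob'
  ; _·_  = λ {V} {W} → act {V} {W}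
  ; resp = λ {V} {W} → resp' {V} {W}
  ; ·-id = λ {W} → id' {W}
  ; ·-∘  = λ {U} {V} {W} → comp' {U} {V} {W}
  }
  where open 𝐏Def Γ

module 𝐏TyDef {Γ : Psh} (A : Ty Γ) where
  open 𝐏Def Γ

  El' : ∀ {W} → Ob' W → Set
  El' {W} γ = El A {♯ W} γ

  res : ∀ {V W} {γ : Ob' W} → El' {W} γ → (φ : Hom V W) → El' {V} (act {V} {W} γ φ)
  res {V} {W} {γ} t φ = _⟨_⟩ A {♯ V} {♯ W} {γ} t (♯H φ)

  resp'' : ∀ {V W} {γ : Ob' W} (t : El' {W} γ) {φ ψ : Hom V W} (e : φ ≈ ψ) →
           subst (El' {V}) (resp' {V} {W} γ {φ} {ψ} e) (res {V} {W} {γ} t φ) ≡ res {V} {W} {γ} t ψ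
  resp'' {V} {W} {γ} t {φ} {ψ} e = Ty.resp A {♯ V} {♯ W} {γ} t {♯H φ} {♯H ψ} (♯-resp {V} {W} {φ} {ψ} e)

  id'' : ∀ {W} {γ : Ob' W} (t : El' {W} γ) → subst (El' {W}) (id' {W} γ) (res {W} {W} {γ} t idH) ≡ t
  id'' {W} {γ} t =
    trans (sym (subst-subst {P = El A {♯ W}} (Psh.resp Γ {♯ W} {♯ W} γ {♯H {W} {W} idH} {idH} (♯-id {W}))))
          (trans (cong (subst (El A {♯ W}) (·-id Γ {♯ W} γ))
                       (Ty.resp A {♯ W} {♯ W} {γ} t {♯H {W} {W} idH} {idH} (♯-id {W})))
                 (⟨id⟩ A {♯ W} {γ} t))

  comp'' : ∀ {U V W} {γ : Ob' W} (t : El' {W} γ) (φ : Hom V W) (ψ : Hom U V) →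
           subst (El' {U}) (comp' {U} {V} {W} γ φ ψ)
             (res {U} {V} {act {V} {W} γ φ} (res {V} {W} {γ} t φ) ψ)
           ≡ res {U} {W} {γ} t (φ ∘H ψ)
  comp'' {U} {V} {W} {γ} t φ ψ =
    trans (sym (subst-subst {P = El A {♯ U}} (·-∘ Γ {♯ U} {♯ V} {♯ W} γ (♯H φ) (♯H ψ))))
          (trans (cong (subst (El A {♯ U}) (Psh.resp Γ {♯ U} {♯ W} γ {♯H φ ∘H ♯H ψ} {♯H (φ ∘H ψ)} (♯-∘ φ ψ)))
                       (⟨∘⟩ A {♯ U} {♯ V} {♯ W} {γ} t (♯H φ) (♯H ψ)))
                 (Ty.resp A {♯ U} {♯ W} {γ} t {♯H φ ∘H ♯H ψ} {♯H (φ ∘H ψ)} (♯-∘ φ ψ)))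

𝐏Ty : {Γ : Psh} → Ty Γ → Ty (𝐏 Γ)
𝐏Ty A = record
  { El   = λ {W} → El' {W}
  ; _⟨_⟩ = λ {V} {W} {γ} → res {V} {W} {γ}
  ; resp = λ {V} {W} {γ} → resp'' {V} {W} {γ}
  ; ⟨id⟩ = λ {W} {γ} → id'' {W} {γ}
  ; ⟨∘⟩  = λ {U} {V} {W} {γ} → comp'' {U} {V} {W} {γ}
  }
  where open 𝐏TyDef A

-- An element t ∈ (𝐏A)[γ] over (W , i : P) is an element of A over
-- ♯(W , i : P), and "degenerate in i" for 𝐏A means: in the image of
-- restriction along ♯ wk_i.  The object ♯(W , i : P) is, up to the
-- associativity of ∨ in the characteristic function of its path names, the
-- object (♯W , i : P), and under this identification ♯ wk_i becomes wk_i.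
-- So discreteness of A at (♯W , i : P) transfers to discreteness of 𝐏A at
-- (W , i : P).
module Submission where

open import Defs
open import Data.Bool using (T)
open import Data.Bool.Properties using (∨-assoc)
open import Data.Nat using (_≡ᵇ_)
open import Data.Product using (Σ; Σ-syntax; _,_)
open import Data.Product.Properties using (Σ-≡,≡→≡; Σ-≡,≡←≡)
open import Relation.Binary.PropositionalEquality
  using (_≡_; refl; sym; cong; subst; module ≡-Reasoning)

module Image (F : Psh) where
  open ≡-Reasoning

  InImage : ∀ {X Z} → Hom X Z → Ob F X → Set
  InImage {Z = Z} h x = Σ[ y ∈ Ob F Z ] (_·_ F y h ≡ x)

  restrict-image : ∀ {X Y Z} {h : Hom X Z} {h' : Hom Y Z} (ψ : Hom Y X) →
                   h' ≈ (h ∘H ψ) → {x : Ob F X} →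
                   InImage h x → InImage h' (_·_ F x ψ)
  restrict-image {h = h} {h'} ψ h'≈hψ {x} (y , yh≡x) = y , (begin
    _·_ F y h'                ≡⟨ Psh.resp F y h'≈hψ ⟩
    _·_ F y (h ∘H ψ)          ≡⟨ sym (·-∘ F y h ψ) ⟩
    _·_ F (_·_ F y h) ψ       ≡⟨ cong (λ z → _·_ F z ψ) yh≡x ⟩
    _·_ F x ψ                 ∎)

  retract-restrict : ∀ {X Y} (α : Hom X Y) (β : Hom Y X) → (β ∘H α) ≈ idH →
                     (x : Ob F X) → _·_ F (_·_ F x β) α ≡ x
  retract-restrict α β βα≈id x = begin
    _·_ F (_·_ F x β) α   ≡⟨ ·-∘ F x β α ⟩
    _·_ F x (β ∘H α)      ≡⟨ Psh.resp F x βα≈id ⟩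
    _·_ F x idH           ≡⟨ ·-id F x ⟩
    x                     ∎

record Comparison {X Y Z : Obj} (w : Hom X Z) (w' : Hom Y Z) : Set where
  field
    α       : Hom X Y
    β       : Hom Y X
    w≈w'α   : w ≈ (w' ∘H α)
    w'≈wβ   : w' ≈ (w ∘H β)
    βα≈id   : (β ∘H α) ≈ idH

module _ (F : Psh) {X Y Z : Obj} {w : Hom X Z} {w' : Hom Y Z}
         (c : Comparison w w') where
  open Image F
  open Comparison c

  image-forth : {x : Ob F X} → InImage w x → InImage w' (_·_ F x β)
  image-forth = restrict-image β w'≈wβ

  image-back : {x : Ob F X} → InImage w' (_·_ F x β) → InImage w x
  image-back {x} im = subst (InImage w) (retract-restrict α β βα≈id x)
                            (restrict-image α w≈w'α im)

∫ : (Γ : Psh) → Ty Γ → Psh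
∫ Γ A = record
  { Ob   = λ W → Σ (Ob Γ W) (El A)
  ; _·_  = λ { (γ , t) φ → _·_ Γ γ φ , _⟨_⟩ A t φ }
  ; resp = λ { (γ , t) e → Σ-≡,≡→≡ (Psh.resp Γ γ e , Ty.resp A t e) }
  ; ·-id = λ { (γ , t) → Σ-≡,≡→≡ (·-id Γ γ , ⟨id⟩ A t) }
  ; ·-∘  = λ { (γ , t) φ ψ → Σ-≡,≡→≡ (·-∘ Γ γ φ ψ , ⟨∘⟩ A t φ ψ) }
  }

-- Degeneracy of a type element along an arbitrary morphism h; the notion
-- DegTy is the case h = wk_i.
module _ {Γ : Psh} (A : Ty Γ) where
  open Image (∫ Γ A)

  DegTyAlong : ∀ {X Z} → Hom X Z → (γ : Ob Γ X) → El A γ → Set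
  DegTyAlong {Z = Z} h γ t =
    Σ[ γ' ∈ Ob Γ Z ] Σ[ e ∈ _·_ Γ γ' h ≡ γ ]
      Σ[ t' ∈ El A γ' ] (subst (El A) e (_⟨_⟩ A t' h) ≡ t)

  deg⇒image : ∀ {X Z} {h : Hom X Z} {γ t} → DegTyAlong h γ t → InImage h (γ , t)
  deg⇒image (γ' , e , t' , q) = (γ' , t') , Σ-≡,≡→≡ (e , q)

  image⇒deg : ∀ {X Z} {h : Hom X Z} {γ t} → InImage h (γ , t) → DegTyAlong h γ t
  image⇒deg ((γ' , t') , p) with Σ-≡,≡←≡ p
  ... | e , q = γ' , e , t' , q

-- ♯ commutes with path extension: ♯(W , i : P) and (♯W , i : P) have the
-- same names, the path names being  (B ∨ P) ∨ [i]  resp.  B ∨ (P ∨ [i]);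
-- the identity assignment of names compares ♯ wk_i with wk_i.
♯-ext-comparison : (W : Obj) (i : Name) (fr : Fresh W i) →
                   Comparison (♯H (wk W i fr)) (wk (♯ W) i fr)
♯-ext-comparison W i fr = record
  { α     = hom nm (λ j ()) (λ j → subst T (∨-assoc (B W j) (P W j) (j ≡ᵇ i)))
  ; β     = hom nm (λ j ()) (λ j → subst T (sym (∨-assoc (B W j) (P W j) (j ≡ᵇ i))))
  ; w≈w'α = λ j p → refl
  ; w'≈wβ = λ j p → refl
  ; βα≈id = λ j p → refl
  }

-- Main theorem: if A is discrete then so is 𝐏A.  Given γ degenerate in i
-- for 𝐏Γ, move (γ , t) to (♯W , i : P) along β, apply discreteness of A
-- there, and move the resulting degeneracy back.
mainTheorem10 : (Γ : Psh) (A : Ty Γ) → Discrete A → Discrete (𝐏Ty A)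
mainTheorem10 Γ A discreteA W i fr γ γ-deg t =
  image⇒deg A (image-back (∫ Γ A) c (deg⇒image A t-deg))
  where
  c : Comparison (♯H (wk W i fr)) (wk (♯ W) i fr)
  c = ♯-ext-comparison W i fr

  β : Hom (ext (♯ W) i fr) (♯ (ext W i fr))
  β = Comparison.β c

  t-deg : DegTy A (♯ W) i fr (_·_ Γ γ β) (_⟨_⟩ A t β)
  t-deg = discreteA (♯ W) i fr (_·_ Γ γ β) (image-forth Γ c γ-deg) (_⟨_⟩ A t β)
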